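{- Let $\mathfrak{P}$ be the covariant powerset functor, $G_1=(E_1,V_1,g_1)$ and $G_2=(E_2,V_2,g_2)$ $\mathfrak{P}$-graphs, $\phi:G_1\to G_2$ a homomorphism, and $\omega_2:E_2\to V_2$ an orientation of $G_2$. Then there exists an orientation $\omega_1:E_1\to V_1$ of $G_1$ such that $\phi=(\phi_E,\phi_V)$ is a homomorphism of graphs of type $V\mapsto V\times\mathfrak{P}V$ from $(E_1,V_1,\langle\omega_1,g_1\rangle)$ to $(E_2,V_2,\langle\omega_2,g_2\rangle)$, i.e. $\omega_2\circ\phi_E=\phi_V\circ\omega_1$ (in addition to $g_2\circ\phi_E=\mathfrak{P}(\phi_V)\circ g_1$).
   Context: For a functor $F:\mathbf{Set}\to\mathbf{Set}$, an $F$-graph is a triple $(E,V,g)$ with sets $E$, $V$ and a map $g:E\to FV$; a homomorphism $(E_1,V_1,g_1)\to(E_2,V_2,g_2)$ is a pair of maps $\phi_E:E_1\to E_2$, $\phi_V:V_1\to V_2$ with $g_2\circ\phi_E=F(\phi_V)\circ g_1$. For the powerset functor, $\mathfrak{P}(f)(A)=f[A]$. An orientation of a $\mathfrak{P}$-graph $(E,V,g)$ is a map $\omega:E\to V$ with $\omega(e)\in g(e)$ for all $e\in E$; $\langle\omega,g\rangle:E\to V\times\mathfrak{P}V$ denotes $e\mapsto(\omega(e),g(e))$. -}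

module Defs where

open import Level using (0ℓ)
open import Relation.Unary using (Pred; _∈_; _≐_)
open import Data.Product using (Σ; _×_)
open import Relation.Binary.PropositionalEquality using (_≡_)

𝔓 : Set → Set₁
𝔓 V = Pred V 0ℓ

𝔓map : {A B : Set} → (A → B) → 𝔓 A → 𝔓 B
𝔓map {A} f X b = Σ A (λ a → (a ∈ X) × (f a ≡ b))

record PGraph : Set₁ where
  field
    E : Set
    V : Set
    g : E → 𝔓 V

open PGraph public

IsPHom : (G₁ G₂ : PGraph) → (E G₁ → E G₂) → (V G₁ → V G₂) → Set
IsPHom G₁ G₂ φE φV = ∀ e → g G₂ (φE e) ≐ 𝔓map φV (g G₁ e)

IsOrientation : (G : PGraph) → (E G → V G) → Set
IsOrientation G ω = ∀ e → ω e ∈ g G e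

-- (φE, φV) is a homomorphism of (V ↦ V × 𝔓V)-graphs
-- (E₁,V₁,⟨ω₁,g₁⟩) → (E₂,V₂,⟨ω₂,g₂⟩), compared componentwise
IsOrientedHom : (G₁ G₂ : PGraph) → (E G₁ → V G₁) → (E G₂ → V G₂)
              → (E G₁ → E G₂) → (V G₁ → V G₂) → Set
IsOrientedHom G₁ G₂ ω₁ ω₂ φE φV =
  (∀ e → ω₂ (φE e) ≡ φV (ω₁ e)) × IsPHom G₁ G₂ φE φV

module Submission where

open import Data.Product using (Σ; _×_; _,_; proj₁; proj₂)
open import Relation.Binary.PropositionalEquality using (_≡_; sym)
open import Defs

-- Since g₂ (φE e) is the image of g₁ e under φV, the vertex ω₂ (φE e) has a
-- preimage in g₁ e; the proof of IsPHom supplies one, and it is the orientation ω₁.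
module PullbackOrientation (G₁ G₂ : PGraph) (φE : E G₁ → E G₂) (φV : V G₁ → V G₂)
         (hom : IsPHom G₁ G₂ φE φV)
         (ω₂ : E G₂ → V G₂) (ω₂-orient : IsOrientation G₂ ω₂) where

  preimage-of-orientation : ∀ e → 𝔓map φV (g G₁ e) (ω₂ (φE e))
  preimage-of-orientation e = proj₁ (hom e) (ω₂-orient (φE e))

  pullback-orientation : E G₁ → V G₁
  pullback-orientation e = proj₁ (preimage-of-orientation e)

  pullback-orientation-isOrientation : IsOrientation G₁ pullback-orientation
  pullback-orientation-isOrientation e = proj₁ (proj₂ (preimage-of-orientation e))

  pullback-orientation-commutes : ∀ e → ω₂ (φE e) ≡ φV (pullback-orientation e)
  pullback-orientation-commutes e = sym (proj₂ (proj₂ (preimage-of-orientation e)))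

theorem8p12 : (G₁ G₂ : PGraph) (φE : E G₁ → E G₂) (φV : V G₁ → V G₂)
    → IsPHom G₁ G₂ φE φV
    → (ω₂ : E G₂ → V G₂) → IsOrientation G₂ ω₂
    → Σ (E G₁ → V G₁) (λ ω₁ → IsOrientation G₁ ω₁ × IsOrientedHom G₁ G₂ ω₁ ω₂ φE φV)
theorem8p12 G₁ G₂ φE φV hom ω₂ ω₂-orient =
  pullback-orientation ,
  pullback-orientation-isOrientation ,
  pullback-orientation-commutes ,
  hom
  where open PullbackOrientation G₁ G₂ φE φV hom ω₂ ω₂-orient
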